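{- For every $n\ge 3$ and all integers $a$ and $d\ge 0$, the sun $S_n$ is not $(a,d)$-distance antimagic.
   Context: The sun $S_n$ is the graph on $2n$ vertices obtained from a cycle $C_n$ by attaching one pendant vertex (leaf) to each vertex of the cycle. For a graph $G$ with $v$ vertices and a bijection $f:V(G)\to\{1,\ldots,v\}$, the vertex-weight of $x$ is $w(x)=\sum_{y\in N(x)} f(y)$, $N(x)$ the set of neighbors of $x$. $f$ is an $(a,d)$-distance antimagic labeling, for fixed integers $a$ and $d\ge 0$, if the multiset of vertex-weights is $\{a,a+d,\ldots,a+(v-1)d\}$; $G$ is $(a,d)$-distance antimagic if it admits such a labeling. -}

module Defs where

open import Data.Nat using (ℕ; zero; suc; _+_; _*_; _≡ᵇ_)
open import Data.Nat.DivMod using (_%_)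
open import Data.Bool using (Bool; true; false; _∧_; _∨_; not; if_then_else_)
open import Data.Fin using (Fin; toℕ)
open import Data.Fin.Properties using ()
open import Data.List using (List; map; allFin)
open import Data.Nat.ListAction using (sum)
open import Data.Integer using (ℤ; +_) renaming (_+_ to _+ℤ_; _*_ to _*ℤ_)
open import Data.Product using (Σ; _×_; _,_)
open import Function.Bundles using (Bijection)
open import Function using (_⤖_)
open import Relation.Binary.PropositionalEquality using (_≡_)

record Graph (v : ℕ) : Set where
  field
    adj : Fin v → Fin v → Bool

open Graph public

weight : ∀ {v} → Graph v → (Fin v → ℕ) → Fin v → ℕ
weight {v} G f x = sum (map (λ y → if adj G x y then f y else 0) (allFin v))

-- A labeling: bijection f : V(G) → {1,…,v}, encoded as a bijection
-- V(G) = Fin v ⤖ Fin v, the label of x being toℕ (f x) + 1.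
label : ∀ {v} → (Fin v ⤖ Fin v) → Fin v → ℕ
label f x = suc (toℕ (Bijection.to f x))

-- f is an (a,d)-distance antimagic labeling: the multiset of vertex
-- weights equals {a, a+d, …, a+(v-1)d}, i.e. there is a bijection
-- g : V(G) → Fin v with w(x) = a + g(x)·d for all x.
IsDistanceAntimagicLabeling : ∀ {v} → Graph v → ℤ → ℕ → (Fin v ⤖ Fin v) → Set
IsDistanceAntimagicLabeling {v} G a d f =
  Σ (Fin v ⤖ Fin v) λ g →
    ∀ x → + (weight G (label f) x) ≡ a +ℤ (+ (toℕ (Bijection.to g x) * d))

IsDistanceAntimagic : ∀ {v} → Graph v → ℤ → ℕ → Set
IsDistanceAntimagic G a d = Σ _ λ f → IsDistanceAntimagicLabeling G a d f

-- The sun S_n on 2n vertices (n ≥ 3): vertex i (0 ≤ i < n) is the cycle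
-- vertex c_i, vertex n + i is the leaf attached to c_i.  Cycle edges are
-- c_i c_{(i+1) mod n}.
sunAdjℕ : ℕ → ℕ → ℕ → Bool
sunAdjℕ n x y = edge x y ∨ edge y x
  where
  isCycle : ℕ → Bool
  isCycle z = Data.Nat._<ᵇ_ z n
  -- directed "generator" edges: c_i → c_{i+1 mod n}, c_i → leaf_i
  edge : ℕ → ℕ → Bool
  edge p q = isCycle p ∧ ((isCycle q ∧ (q ≡ᵇ ((p + 1) % suc (Data.Nat.pred n))))
                         ∨ (q ≡ᵇ (n + p)))

sun : (n : ℕ) → Graph (n + n)
sun n = record { adj = λ x y → sunAdjℕ n (toℕ x) (toℕ y) }

module Submission where

-- Call the cycle vertices c_i and the leaves l_i, and suppose the weights are
-- a + κ(x)·d for a bijection κ onto {0, …, 2n−1}.  The leaf l_i has weight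
-- f(c_i), so every cycle label is ≡ a (mod d); the vertex c_i has weight
-- f(c_{i−1}) + f(c_{i+1}) + f(l_i), so every leaf label is ≡ −a (mod d).  As
-- each of the labels 1, 2, 3 is ≡ ±a, d divides 1: either two consecutive
-- ones lie in the same class, or the signs alternate and 1 = 2·1 + 2 − 3 is
-- ≡ ±(2a − a − a) = 0.  For d = 1, summing
-- w(c_i) − w(l_i) = κ(c_i) − κ(l_i) over i shows that the sum of all labels
-- 1, …, 2n equals Σ κ(c_i) − Σ κ(l_i), which is at most the smaller sum
-- 0 + 1 + … + (2n − 1).

open import Defs
open import Data.Nat using (ℕ; zero; suc; _+_; _*_; _≤_; _<_; _≥_; s≤s; z≤n; NonZero; _≡ᵇ_; _<ᵇ_; _≟_; _<?_)
open import Data.Nat.Properties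
  using (+-assoc; +-comm; +-identityʳ; *-identityʳ; +-cancelˡ-≡; <⇒≱; <⇒≢; ≤-trans; m≤m+n; m+n≮m; m+1+n≢m; +-0-commutativeMonoid)
open import Data.Nat.DivMod using (_%_; _/_; m%n<n; m%n%n≡m%n; %-distribˡ-+; [m+n]%n≡m%n; m<n⇒m%n≡m; m≡m%n+[m/n]*n)
open import Data.Nat.Divisibility using (divides; ∣⇒≤; ∣1⇒≡1) renaming (_∣_ to _∣ℕ_)
import Data.Nat.Tactic.RingSolver as ℕ-Solver
open import Data.Integer using (ℤ; +_; -_; _-_; 0ℤ) renaming (_+_ to _+ℤ_; _*_ to _*ℤ_)
open import Data.Integer.Properties using (pos-+; pos-*; +-inverseˡ; +-inverseʳ) renaming (+-injective to +-injectiveℤ)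
open import Data.Integer.Divisibility.Signed using (_∣_; divides; ∣⇒∣ᵤ; ∣m∣n⇒∣m+n; ∣m∣n⇒∣m-n)
import Data.Integer.Tactic.RingSolver as ℤ-Solver
open import Data.Bool using (Bool; true; false; _∨_; if_then_else_)
open import Data.Bool.Properties using (∨-identityʳ; ∨-zeroʳ)
open import Data.Fin using (Fin; zero; suc; toℕ; fromℕ<; _↑ˡ_; _↑ʳ_; punchIn; punchOut; splitAt)
open import Data.Fin.Properties
  using (toℕ-injective; toℕ-fromℕ<; toℕ<n; toℕ-↑ˡ; toℕ-↑ʳ; join-splitAt; punchInᵢ≢i; punchIn-punchOut; punchIn-injective)
open import Data.Fin.Permutation using (Permutation; permutation)
open import Data.List using (allFin; map; tabulate)
open import Data.List.Properties using (map-tabulate)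
open import Data.Nat.ListAction using (sum)
open import Data.Sum using (_⊎_; inj₁; inj₂)
open import Data.Product using (_,_)
open import Data.Empty using (⊥)
open import Function using (id; _∘_; _⤖_)
open import Function.Bundles using (Bijection)
open import Function.Properties.Bijection using (⤖⇒↔)
open import Relation.Nullary using (¬_)
open import Relation.Nullary.Decidable using (dec-true; dec-false)
open import Relation.Binary.PropositionalEquality
open import Algebra.Properties.CommutativeMonoid.Sum +-0-commutativeMonoid
  using (sum-remove; sum-permute; sum-cong-≗; sum-replicate-zero; ∑-distrib-+) renaming (sum to Σ)

private variable
  k l : ℕ

sum-tabulate : (t : Fin k → ℕ) → sum (tabulate t) ≡ Σ t
sum-tabulate {zero} t = refl
sum-tabulate {suc k} t = cong (_+_ (t zero)) (sum-tabulate (t ∘ suc))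

sum-allFin : (t : Fin k → ℕ) → sum (map t (allFin k)) ≡ Σ t
sum-allFin t = trans (cong sum (map-tabulate id t)) (sum-tabulate t)

Σ-++ : (t : Fin (k + l) → ℕ) → Σ t ≡ Σ (t ∘ (_↑ˡ l)) + Σ (t ∘ (k ↑ʳ_))
Σ-++ {zero} t = refl
Σ-++ {suc k} {l} t = trans (cong (_+_ (t zero)) (Σ-++ {k} {l} (t ∘ suc))) (sym (+-assoc (t zero) _ _))

Σ-zero : (t : Fin k → ℕ) → (∀ j → t j ≡ 0) → Σ t ≡ 0
Σ-zero {k} t t≡0 = trans (sum-cong-≗ t≡0) (sum-replicate-zero k)

Σ-single : (t : Fin k → ℕ) (i : Fin k) → (∀ j → j ≢ i → t j ≡ 0) → Σ t ≡ t i
Σ-single {suc k} t i t≡0 = begin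
  Σ t                        ≡⟨ sum-remove t ⟩
  t i + Σ (t ∘ punchIn i)    ≡⟨ cong (_+_ (t i)) (Σ-zero _ λ j → t≡0 _ (punchInᵢ≢i i j)) ⟩
  t i + 0                    ≡⟨ +-identityʳ (t i) ⟩
  t i                        ∎
  where open ≡-Reasoning

Σ-pair : (t : Fin k → ℕ) {i i′ : Fin k} → i ≢ i′ →
         (∀ j → j ≢ i → j ≢ i′ → t j ≡ 0) → Σ t ≡ t i + t i′
Σ-pair {suc k} t {i} {i′} i≢i′ t≡0 = begin
  Σ t                                    ≡⟨ sum-remove t ⟩
  t i + Σ (t ∘ punchIn i)                ≡⟨ cong (_+_ (t i)) (Σ-single _ (punchOut i≢i′) vanish) ⟩
  t i + t (punchIn i (punchOut i≢i′))    ≡⟨ cong (λ j → t i + t j) (punchIn-punchOut i≢i′) ⟩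
  t i + t i′                             ∎
  where
  open ≡-Reasoning
  vanish : ∀ j → j ≢ punchOut i≢i′ → t (punchIn i j) ≡ 0
  vanish j j≢ = t≡0 _ (punchInᵢ≢i i j) λ eq →
    j≢ (punchIn-injective i j _ (trans eq (sym (punchIn-punchOut i≢i′))))

Σ-suc : (t : Fin k → ℕ) → Σ (suc ∘ t) ≡ k + Σ t
Σ-suc {zero} t = refl
Σ-suc {suc k} t = cong suc (begin
  t zero + Σ (suc ∘ t ∘ suc)    ≡⟨ cong (_+_ (t zero)) (Σ-suc (t ∘ suc)) ⟩
  t zero + (k + Σ (t ∘ suc))    ≡⟨ +-comm (t zero) _ ⟩
  k + Σ (t ∘ suc) + t zero      ≡⟨ +-assoc k _ _ ⟩
  k + (Σ (t ∘ suc) + t zero)    ≡⟨ cong (_+_ k) (+-comm _ (t zero)) ⟩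
  k + Σ t                       ∎)
  where open ≡-Reasoning

Σ-⤖ : (f : Fin k ⤖ Fin k) (t : Fin k → ℕ) → Σ (t ∘ Bijection.to f) ≡ Σ t
Σ-⤖ f t = sym (sum-permute t (⤖⇒↔ f))

module _ (p : Fin k → Bool) (t : Fin k → ℕ) where
  private
    p·t : Fin k → ℕ
    p·t j = if p j then t j else 0

  Σ-if-none : (∀ j → p j ≡ false) → Σ p·t ≡ 0
  Σ-if-none p≡false = Σ-zero p·t (λ j → cong (if_then t j else 0) (p≡false j))

  Σ-if-single : ∀ {i} → p i ≡ true → (∀ j → j ≢ i → p j ≡ false) → Σ p·t ≡ t i
  Σ-if-single {i} pi p≡false = begin
    Σ p·t    ≡⟨ Σ-single p·t i (λ j j≢i → cong (if_then t j else 0) (p≡false j j≢i)) ⟩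
    p·t i    ≡⟨ cong (if_then t i else 0) pi ⟩
    t i      ∎
    where open ≡-Reasoning

  Σ-if-pair : ∀ {i i′} → i ≢ i′ → p i ≡ true → p i′ ≡ true →
              (∀ j → j ≢ i → j ≢ i′ → p j ≡ false) → Σ p·t ≡ t i + t i′
  Σ-if-pair {i} {i′} i≢i′ pi pi′ p≡false = begin
    Σ p·t            ≡⟨ Σ-pair p·t i≢i′ (λ j j≢i j≢i′ → cong (if_then t j else 0) (p≡false j j≢i j≢i′)) ⟩
    p·t i + p·t i′   ≡⟨ cong₂ _+_ (cong (if_then t i else 0) pi) (cong (if_then t i′ else 0) pi′) ⟩
    t i + t i′       ∎
    where open ≡-Reasoning

weight-++ : (G : Graph (k + l)) (F : Fin (k + l) → ℕ) (x : Fin (k + l)) →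
  weight G F x ≡ Σ (λ j → if adj G x (j ↑ˡ l) then F (j ↑ˡ l) else 0)
               + Σ (λ j → if adj G x (k ↑ʳ j) then F (k ↑ʳ j) else 0)
weight-++ {k} {l} G F x = trans (sum-allFin t) (Σ-++ {k} {l} t)
  where
  t : Fin (k + l) → ℕ
  t y = if adj G x y then F y else 0

[m%d+n]%d≡[m+n]%d : ∀ m n d .{{_ : NonZero d}} → (m % d + n) % d ≡ (m + n) % d
[m%d+n]%d≡[m+n]%d m n d = begin
  (m % d + n) % d            ≡⟨ %-distribˡ-+ (m % d) n d ⟩
  (m % d % d + n % d) % d    ≡⟨ cong (λ x → (x + n % d) % d) (m%n%n≡m%n m d) ⟩
  (m % d + n % d) % d        ≡⟨ %-distribˡ-+ m n d ⟨
  (m + n) % d                ∎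
  where open ≡-Reasoning

[m+n]%d≡m⇒d∣n : ∀ m n d .{{_ : NonZero d}} → (m + n) % d ≡ m → d ∣ℕ n
[m+n]%d≡m⇒d∣n m n d eq = divides ((m + n) / d) (+-cancelˡ-≡ m n _ (begin
  m + n                            ≡⟨ m≡m%n+[m/n]*n (m + n) d ⟩
  (m + n) % d + (m + n) / d * d    ≡⟨ cong (_+ (m + n) / d * d) eq ⟩
  m + (m + n) / d * d              ∎))
  where open ≡-Reasoning

module Rotation (m : ℕ) where

  rotate : ℕ → Fin (suc m) → Fin (suc m)
  rotate k i = fromℕ< (m%n<n (toℕ i + k) (suc m))

  toℕ-rotate : ∀ k i → toℕ (rotate k i) ≡ (toℕ i + k) % suc m
  toℕ-rotate k i = toℕ-fromℕ< (m%n<n (toℕ i + k) (suc m))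

  toℕ-rotate-rotate : ∀ k l i → toℕ (rotate l (rotate k i)) ≡ (toℕ i + (k + l)) % suc m
  toℕ-rotate-rotate k l i = begin
    toℕ (rotate l (rotate k i))          ≡⟨ toℕ-rotate l (rotate k i) ⟩
    (toℕ (rotate k i) + l) % suc m       ≡⟨ cong (λ x → (x + l) % suc m) (toℕ-rotate k i) ⟩
    ((toℕ i + k) % suc m + l) % suc m    ≡⟨ [m%d+n]%d≡[m+n]%d (toℕ i + k) l (suc m) ⟩
    (toℕ i + k + l) % suc m              ≡⟨ cong (_% suc m) (+-assoc (toℕ i) k l) ⟩
    (toℕ i + (k + l)) % suc m            ∎
    where open ≡-Reasoning

  rotate-inverse : ∀ k l → k + l ≡ suc m → ∀ i → rotate l (rotate k i) ≡ i
  rotate-inverse k l k+l≡n i = toℕ-injective (begin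
    toℕ (rotate l (rotate k i))    ≡⟨ toℕ-rotate-rotate k l i ⟩
    (toℕ i + (k + l)) % suc m      ≡⟨ cong (λ x → (toℕ i + x) % suc m) k+l≡n ⟩
    (toℕ i + suc m) % suc m        ≡⟨ [m+n]%n≡m%n (toℕ i) (suc m) ⟩
    toℕ i % suc m                  ≡⟨ m<n⇒m%n≡m (toℕ<n i) ⟩
    toℕ i                          ∎)
    where open ≡-Reasoning

  next prev : Fin (suc m) → Fin (suc m)
  next = rotate 1
  prev = rotate m

  next-prev : ∀ i → next (prev i) ≡ i
  next-prev = rotate-inverse m 1 (+-comm m 1)

  prev-next : ∀ i → prev (next i) ≡ i
  prev-next = rotate-inverse 1 m refl

  nextₚ prevₚ : Permutation (suc m) (suc m)
  nextₚ = permutation next prev next-prev prev-next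
  prevₚ = permutation prev next prev-next next-prev

  -- next (next i) ≡ i would make the cycle length divide 2.
  next≢prev : 3 ≤ suc m → ∀ i → next i ≢ prev i
  next≢prev 3≤n i next≡prev = <⇒≱ 3≤n (∣⇒≤ ([m+n]%d≡m⇒d∣n (toℕ i) 2 (suc m) (begin
    (toℕ i + 2) % suc m    ≡⟨ toℕ-rotate-rotate 1 1 i ⟨
    toℕ (next (next i))    ≡⟨ cong (toℕ ∘ next) next≡prev ⟩
    toℕ (next (prev i))    ≡⟨ cong toℕ (next-prev i) ⟩
    toℕ i                  ∎)))
    where open ≡-Reasoning

n+i<ᵇn : ∀ n i → (n + i <ᵇ n) ≡ false
n+i<ᵇn n i = dec-false (n + i <? n) (m+n≮m n i)

n+i≡ᵇn+j : ∀ n i j → (n + i ≡ᵇ n + j) ≡ (i ≡ᵇ j)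
n+i≡ᵇn+j zero i j = refl
n+i≡ᵇn+j (suc n) i j = n+i≡ᵇn+j n i j

<⇒<ᵇ≡true : ∀ {i n} → i < n → (i <ᵇ n) ≡ true
<⇒<ᵇ≡true {i} {n} i<n = dec-true (i <? n) i<n

<⇒≡ᵇ+≡false : ∀ {i n} → i < n → ∀ j → (i ≡ᵇ n + j) ≡ false
<⇒≡ᵇ+≡false {i} {n} i<n j = dec-false (i ≟ n + j) (<⇒≢ (≤-trans i<n (m≤m+n n j)))

toℕ-≡ᵇ-refl : (i : Fin k) → (toℕ i ≡ᵇ toℕ i) ≡ true
toℕ-≡ᵇ-refl i = dec-true (toℕ i ≟ toℕ i) refl

toℕ-≡ᵇ-≢ : {i j : Fin k} → i ≢ j → (toℕ i ≡ᵇ toℕ j) ≡ false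
toℕ-≡ᵇ-≢ {i = i} {j} i≢j = dec-false (toℕ i ≟ toℕ j) (i≢j ∘ toℕ-injective)

module Sun (m : ℕ) where
  open Rotation m public
  private
    n = suc m

  sunAdj-leaf-leaf : ∀ i j → sunAdjℕ n (n + i) (n + j) ≡ false
  sunAdj-leaf-leaf i j rewrite n+i<ᵇn n i | n+i<ᵇn n j = refl

  sunAdj-leaf-cycle : ∀ i {j} → j < n → sunAdjℕ n (n + i) j ≡ (i ≡ᵇ j)
  sunAdj-leaf-cycle i {j} j<n
    rewrite n+i<ᵇn n i | <⇒<ᵇ≡true j<n | n+i≡ᵇn+j n i j = refl

  sunAdj-cycle-leaf : ∀ {i} j → i < n → sunAdjℕ n i (n + j) ≡ (j ≡ᵇ i)
  sunAdj-cycle-leaf {i} j i<n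
    rewrite n+i<ᵇn n j | <⇒<ᵇ≡true i<n | n+i≡ᵇn+j n j i = ∨-identityʳ (j ≡ᵇ i)

  sunAdj-cycle-cycle : ∀ {i j} → i < n → j < n →
    sunAdjℕ n i j ≡ (j ≡ᵇ (i + 1) % n) ∨ (i ≡ᵇ (j + 1) % n)
  sunAdj-cycle-cycle {i} {j} i<n j<n
    rewrite <⇒<ᵇ≡true i<n | <⇒<ᵇ≡true j<n | <⇒≡ᵇ+≡false i<n j | <⇒≡ᵇ+≡false j<n i
    | ∨-identityʳ (j ≡ᵇ (i + 1) % n) | ∨-identityʳ (i ≡ᵇ (j + 1) % n) = refl

  cycle leaf : Fin n → Fin (n + n)
  cycle i = i ↑ˡ n
  leaf i = n ↑ʳ i

  adj-sun : ∀ {x y x′ y′} → toℕ x ≡ x′ → toℕ y ≡ y′ → adj (sun n) x y ≡ sunAdjℕ n x′ y′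
  adj-sun = cong₂ (sunAdjℕ n)

  adj-leaf-leaf : ∀ i j → adj (sun n) (leaf i) (leaf j) ≡ false
  adj-leaf-leaf i j = trans (adj-sun (toℕ-↑ʳ n i) (toℕ-↑ʳ n j)) (sunAdj-leaf-leaf (toℕ i) (toℕ j))

  adj-leaf-cycle : ∀ i j → adj (sun n) (leaf i) (cycle j) ≡ (toℕ i ≡ᵇ toℕ j)
  adj-leaf-cycle i j = trans (adj-sun (toℕ-↑ʳ n i) (toℕ-↑ˡ j n)) (sunAdj-leaf-cycle (toℕ i) (toℕ<n j))

  adj-cycle-leaf : ∀ i j → adj (sun n) (cycle i) (leaf j) ≡ (toℕ j ≡ᵇ toℕ i)
  adj-cycle-leaf i j = trans (adj-sun (toℕ-↑ˡ i n) (toℕ-↑ʳ n j)) (sunAdj-cycle-leaf (toℕ j) (toℕ<n i))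

  adj-cycle-cycle : ∀ i j →
    adj (sun n) (cycle i) (cycle j) ≡ (toℕ j ≡ᵇ toℕ (next i)) ∨ (toℕ i ≡ᵇ toℕ (next j))
  adj-cycle-cycle i j = begin
    adj (sun n) (cycle i) (cycle j)
      ≡⟨ adj-sun (toℕ-↑ˡ i n) (toℕ-↑ˡ j n) ⟩
    sunAdjℕ n (toℕ i) (toℕ j)
      ≡⟨ sunAdj-cycle-cycle (toℕ<n i) (toℕ<n j) ⟩
    (toℕ j ≡ᵇ (toℕ i + 1) % n) ∨ (toℕ i ≡ᵇ (toℕ j + 1) % n)
      ≡⟨ cong₂ (λ x y → (toℕ j ≡ᵇ x) ∨ (toℕ i ≡ᵇ y)) (toℕ-rotate 1 i) (toℕ-rotate 1 j) ⟨
    (toℕ j ≡ᵇ toℕ (next i)) ∨ (toℕ i ≡ᵇ toℕ (next j))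
      ∎
    where open ≡-Reasoning

  module _ (F : Fin (n + n) → ℕ) where

    weight-leaf : ∀ i → weight (sun n) F (leaf i) ≡ F (cycle i)
    weight-leaf i = begin
      weight (sun n) F (leaf i)   ≡⟨ weight-++ {n} {n} (sun n) F (leaf i) ⟩
      Σ (λ j → if adj (sun n) (leaf i) (cycle j) then F (cycle j) else 0)
        + Σ (λ j → if adj (sun n) (leaf i) (leaf j) then F (leaf j) else 0)
                                  ≡⟨ cong₂ _+_ cycles leaves ⟩
      F (cycle i) + 0             ≡⟨ +-identityʳ _ ⟩
      F (cycle i)                 ∎
      where
      open ≡-Reasoning
      cycles = Σ-if-single (adj (sun n) (leaf i) ∘ cycle) (F ∘ cycle)
        (trans (adj-leaf-cycle i i) (toℕ-≡ᵇ-refl i))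
        (λ j j≢i → trans (adj-leaf-cycle i j) (toℕ-≡ᵇ-≢ (j≢i ∘ sym)))
      leaves = Σ-if-none (adj (sun n) (leaf i) ∘ leaf) (F ∘ leaf) (adj-leaf-leaf i)

    weight-cycle : 3 ≤ n → ∀ i →
      weight (sun n) F (cycle i) ≡ F (cycle (next i)) + F (cycle (prev i)) + F (leaf i)
    weight-cycle 3≤n i = begin
      weight (sun n) F (cycle i)   ≡⟨ weight-++ {n} {n} (sun n) F (cycle i) ⟩
      Σ (λ j → if adj (sun n) (cycle i) (cycle j) then F (cycle j) else 0)
        + Σ (λ j → if adj (sun n) (cycle i) (leaf j) then F (leaf j) else 0)
                                   ≡⟨ cong₂ _+_ cycles leaves ⟩
      F (cycle (next i)) + F (cycle (prev i)) + F (leaf i)  ∎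
      where
      open ≡-Reasoning
      adjacent-next : adj (sun n) (cycle i) (cycle (next i)) ≡ true
      adjacent-next = trans (adj-cycle-cycle i (next i))
        (cong (_∨ (toℕ i ≡ᵇ toℕ (next (next i)))) (toℕ-≡ᵇ-refl (next i)))
      adjacent-prev : adj (sun n) (cycle i) (cycle (prev i)) ≡ true
      adjacent-prev = begin
        adj (sun n) (cycle i) (cycle (prev i))
          ≡⟨ adj-cycle-cycle i (prev i) ⟩
        (toℕ (prev i) ≡ᵇ toℕ (next i)) ∨ (toℕ i ≡ᵇ toℕ (next (prev i)))
          ≡⟨ cong (λ x → (toℕ (prev i) ≡ᵇ toℕ (next i)) ∨ (toℕ i ≡ᵇ toℕ x)) (next-prev i) ⟩
        (toℕ (prev i) ≡ᵇ toℕ (next i)) ∨ (toℕ i ≡ᵇ toℕ i)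
          ≡⟨ cong ((toℕ (prev i) ≡ᵇ toℕ (next i)) ∨_) (toℕ-≡ᵇ-refl i) ⟩
        (toℕ (prev i) ≡ᵇ toℕ (next i)) ∨ true
          ≡⟨ ∨-zeroʳ _ ⟩
        true
          ∎
      non-adjacent : ∀ j → j ≢ next i → j ≢ prev i → adj (sun n) (cycle i) (cycle j) ≡ false
      non-adjacent j j≢next j≢prev = trans (adj-cycle-cycle i j) (cong₂ _∨_
        (toℕ-≡ᵇ-≢ j≢next)
        (toℕ-≡ᵇ-≢ {i = i} {next j} λ i≡next-j → j≢prev (trans (sym (prev-next j)) (cong prev (sym i≡next-j)))))
      cycles = Σ-if-pair (adj (sun n) (cycle i) ∘ cycle) (F ∘ cycle)
        (next≢prev 3≤n i) adjacent-next adjacent-prev non-adjacent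
      leaves = Σ-if-single (adj (sun n) (cycle i) ∘ leaf) (F ∘ leaf)
        (trans (adj-cycle-leaf i i) (toℕ-≡ᵇ-refl i))
        (λ j j≢i → trans (adj-cycle-leaf i j) (toℕ-≡ᵇ-≢ j≢i))

infix 4 _≡±_[mod_]

_≡±_[mod_] : ℤ → ℤ → ℤ → Set
x ≡± a [mod k ] = k ∣ x - a ⊎ k ∣ x +ℤ a

∣-consecutive : ∀ {k} x b → k ∣ (x +ℤ + 1) +ℤ b → k ∣ x +ℤ b → k ∣ + 1
∣-consecutive {k} x b k∣x+1+b k∣x+b = subst (k ∣_) (difference x b) (∣m∣n⇒∣m-n k∣x+1+b k∣x+b)
  where
  difference : ∀ x b → ((x +ℤ + 1) +ℤ b) - (x +ℤ b) ≡ + 1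
  difference = ℤ-Solver.solve-∀

∣-alternating : ∀ {k} b c → k ∣ + 1 +ℤ b → k ∣ + 2 +ℤ c → k ∣ + 3 +ℤ b → b +ℤ c ≡ 0ℤ → k ∣ + 1
∣-alternating {k} b c k∣1+b k∣2+c k∣3+b b+c≡0 =
  subst (k ∣_) (trans (combination b c) (cong (+ 1 +ℤ_) b+c≡0))
    (∣m∣n⇒∣m-n (∣m∣n⇒∣m+n (∣m∣n⇒∣m+n k∣1+b k∣1+b) k∣2+c) k∣3+b)
  where
  combination : ∀ b c → (((+ 1 +ℤ b) +ℤ (+ 1 +ℤ b)) +ℤ (+ 2 +ℤ c)) - (+ 3 +ℤ b) ≡ + 1 +ℤ (b +ℤ c)
  combination = ℤ-Solver.solve-∀

≡±-1-2-3⇒∣1 : ∀ {k a} → + 1 ≡± a [mod k ] → + 2 ≡± a [mod k ] → + 3 ≡± a [mod k ] → k ∣ + 1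
≡±-1-2-3⇒∣1 {a = a} (inj₁ k∣1-a) (inj₁ k∣2-a) _            = ∣-consecutive (+ 1) (- a) k∣2-a k∣1-a
≡±-1-2-3⇒∣1 {a = a} (inj₂ k∣1+a) (inj₂ k∣2+a) _            = ∣-consecutive (+ 1) a k∣2+a k∣1+a
≡±-1-2-3⇒∣1 {a = a} _            (inj₁ k∣2-a) (inj₁ k∣3-a) = ∣-consecutive (+ 2) (- a) k∣3-a k∣2-a
≡±-1-2-3⇒∣1 {a = a} _            (inj₂ k∣2+a) (inj₂ k∣3+a) = ∣-consecutive (+ 2) a k∣3+a k∣2+a
≡±-1-2-3⇒∣1 {a = a} (inj₁ k∣1-a) (inj₂ k∣2+a) (inj₁ k∣3-a) = ∣-alternating (- a) a k∣1-a k∣2+a k∣3-a (+-inverseˡ a)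
≡±-1-2-3⇒∣1 {a = a} (inj₂ k∣1+a) (inj₁ k∣2-a) (inj₂ k∣3+a) = ∣-alternating a (- a) k∣1+a k∣2-a k∣3+a (+-inverseʳ a)

∣[p+q+x]-a⇒∣x+a : ∀ {k a} p q x → k ∣ (p +ℤ q +ℤ x) - a → k ∣ p - a → k ∣ q - a → k ∣ x +ℤ a
∣[p+q+x]-a⇒∣x+a {k} {a} p q x k∣w-a k∣p-a k∣q-a =
  subst (k ∣_) (identity p q x a) (∣m∣n⇒∣m-n (∣m∣n⇒∣m-n k∣w-a k∣p-a) k∣q-a)
  where
  identity : ∀ p q x a → ((p +ℤ q +ℤ x) - a - (p - a)) - (q - a) ≡ x +ℤ a
  identity = ℤ-Solver.solve-∀

offset-balance : ∀ {a : ℤ} {u v p q : ℕ} → + u ≡ a +ℤ + p → + v ≡ a +ℤ + q → u + q ≡ v + p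
offset-balance {a} {u} {v} {p} {q} u≡a+p v≡a+q = +-injectiveℤ (begin
  + (u + q)          ≡⟨ pos-+ u q ⟩
  + u +ℤ + q         ≡⟨ cong (_+ℤ + q) u≡a+p ⟩
  a +ℤ + p +ℤ + q    ≡⟨ swap a (+ p) (+ q) ⟩
  a +ℤ + q +ℤ + p    ≡⟨ cong (_+ℤ + p) v≡a+q ⟨
  + v +ℤ + p         ≡⟨ pos-+ v p ⟨
  + (v + p)          ∎)
  where
  open ≡-Reasoning
  swap : ∀ a x y → a +ℤ x +ℤ y ≡ a +ℤ y +ℤ x
  swap = ℤ-Solver.solve-∀

module AntimagicSun (k : ℕ) (a : ℤ) (d : ℕ) (f g : Fin (3 + k + (3 + k)) ⤖ Fin (3 + k + (3 + k)))
  (weight≡ : ∀ x → + weight (sun (3 + k)) (label f) x ≡ a +ℤ + (toℕ (Bijection.to g x) * d)) where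

  open Sun (2 + k)

  private
    n = 3 + k
    ℓ = label f
    w = weight (sun n) ℓ
    κ : Fin (n + n) → ℕ
    κ x = toℕ (Bijection.to g x)
    3≤n : 3 ≤ n
    3≤n = s≤s (s≤s (s≤s z≤n))

  d∣weight-a : ∀ x → + d ∣ + w x - a
  d∣weight-a x = divides (+ κ x) (begin
    + w x - a                     ≡⟨ cong (_- a) (weight≡ x) ⟩
    a +ℤ + (κ x * d) - a          ≡⟨ cancel a (+ (κ x * d)) ⟩
    + (κ x * d)                   ≡⟨ pos-* (κ x) d ⟩
    + κ x *ℤ + d                  ∎)
    where
    open ≡-Reasoning
    cancel : ∀ a y → a +ℤ y - a ≡ y
    cancel = ℤ-Solver.solve-∀

  d∣cycle-label-a : ∀ i → + d ∣ + ℓ (cycle i) - a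
  d∣cycle-label-a i = subst (λ v → + d ∣ + v - a) (weight-leaf ℓ i) (d∣weight-a (leaf i))

  d∣leaf-label+a : ∀ i → + d ∣ + ℓ (leaf i) +ℤ a
  d∣leaf-label+a i = ∣[p+q+x]-a⇒∣x+a {a = a} (+ ℓ (cycle (next i))) (+ ℓ (cycle (prev i))) (+ ℓ (leaf i))
    (subst (λ v → + d ∣ v - a) w≡ (d∣weight-a (cycle i)))
    (d∣cycle-label-a (next i)) (d∣cycle-label-a (prev i))
    where
    w≡ : + w (cycle i) ≡ + ℓ (cycle (next i)) +ℤ + ℓ (cycle (prev i)) +ℤ + ℓ (leaf i)
    w≡ = begin
      + w (cycle i)
        ≡⟨ cong +_ (weight-cycle ℓ 3≤n i) ⟩
      + (ℓ (cycle (next i)) + ℓ (cycle (prev i)) + ℓ (leaf i))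
        ≡⟨ pos-+ (ℓ (cycle (next i)) + ℓ (cycle (prev i))) (ℓ (leaf i)) ⟩
      + (ℓ (cycle (next i)) + ℓ (cycle (prev i))) +ℤ + ℓ (leaf i)
        ≡⟨ cong (_+ℤ + ℓ (leaf i)) (pos-+ (ℓ (cycle (next i))) (ℓ (cycle (prev i)))) ⟩
      + ℓ (cycle (next i)) +ℤ + ℓ (cycle (prev i)) +ℤ + ℓ (leaf i)
        ∎
      where open ≡-Reasoning

  label≡± : ∀ x → + ℓ x ≡± a [mod + d ]
  label≡± x with splitAt n x | join-splitAt n n x
  ... | inj₁ i | refl = inj₁ (d∣cycle-label-a i)
  ... | inj₂ i | refl = inj₂ (d∣leaf-label+a i)

  value≡± : ∀ v → + suc (toℕ v) ≡± a [mod + d ]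
  value≡± v with Bijection.strictlySurjective f v
  ... | x , refl = label≡± x

  d≡1 : d ≡ 1
  d≡1 = ∣1⇒≡1 (∣⇒∣ᵤ (≡±-1-2-3⇒∣1 {a = a} (value≡± zero) (value≡± (suc zero)) (value≡± (suc (suc zero)))))

  private
    C L Kc Kl : ℕ
    C = Σ (ℓ ∘ cycle)
    L = Σ (ℓ ∘ leaf)
    Kc = Σ (κ ∘ cycle)
    Kl = Σ (κ ∘ leaf)

  Σ-weight-cycle : Σ (w ∘ cycle) ≡ C + C + L
  Σ-weight-cycle = begin
    Σ (w ∘ cycle)
      ≡⟨ sum-cong-≗ (weight-cycle ℓ 3≤n) ⟩
    Σ (λ i → ℓ (cycle (next i)) + ℓ (cycle (prev i)) + ℓ (leaf i))
      ≡⟨ ∑-distrib-+ (λ i → ℓ (cycle (next i)) + ℓ (cycle (prev i))) (ℓ ∘ leaf) ⟩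
    Σ (λ i → ℓ (cycle (next i)) + ℓ (cycle (prev i))) + L
      ≡⟨ cong (_+ L) (∑-distrib-+ (ℓ ∘ cycle ∘ next) (ℓ ∘ cycle ∘ prev)) ⟩
    Σ (ℓ ∘ cycle ∘ next) + Σ (ℓ ∘ cycle ∘ prev) + L
      ≡⟨ cong₂ (λ x y → x + y + L) (sum-permute (ℓ ∘ cycle) nextₚ) (sum-permute (ℓ ∘ cycle) prevₚ) ⟨
    C + C + L
      ∎
    where open ≡-Reasoning

  Σ-weight-leaf : Σ (w ∘ leaf) ≡ C
  Σ-weight-leaf = sum-cong-≗ (weight-leaf ℓ)

  Σ-label : C + L ≡ (n + n) + (Kc + Kl)
  Σ-label = begin
    C + L                               ≡⟨ Σ-++ {n} {n} ℓ ⟨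
    Σ ℓ                                 ≡⟨ Σ-suc (toℕ ∘ Bijection.to f) ⟩
    (n + n) + Σ (toℕ ∘ Bijection.to f)  ≡⟨ cong (_+_ (n + n)) (trans (Σ-⤖ f toℕ) (sym (Σ-⤖ g toℕ))) ⟩
    (n + n) + Σ κ                       ≡⟨ cong (_+_ (n + n)) (Σ-++ {n} {n} κ) ⟩
    (n + n) + (Kc + Kl)                 ∎
    where open ≡-Reasoning

  balance : ∀ i → w (cycle i) + κ (leaf i) ≡ w (leaf i) + κ (cycle i)
  balance i = begin
    w (cycle i) + κ (leaf i)        ≡⟨ cong (_+_ (w (cycle i))) (κ*d≡κ (leaf i)) ⟨
    w (cycle i) + κ (leaf i) * d    ≡⟨ offset-balance {a} (weight≡ (cycle i)) (weight≡ (leaf i)) ⟩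
    w (leaf i) + κ (cycle i) * d    ≡⟨ cong (_+_ (w (leaf i))) (κ*d≡κ (cycle i)) ⟩
    w (leaf i) + κ (cycle i)        ∎
    where
    open ≡-Reasoning
    κ*d≡κ : ∀ x → κ x * d ≡ κ x
    κ*d≡κ x = trans (cong (κ x *_) d≡1) (*-identityʳ (κ x))

  Σ-balance : C + C + L + Kl ≡ C + Kc
  Σ-balance = begin
    C + C + L + Kl                            ≡⟨ cong (_+ Kl) Σ-weight-cycle ⟨
    Σ (w ∘ cycle) + Kl                        ≡⟨ ∑-distrib-+ (w ∘ cycle) (κ ∘ leaf) ⟨
    Σ (λ i → w (cycle i) + κ (leaf i))        ≡⟨ sum-cong-≗ balance ⟩
    Σ (λ i → w (leaf i) + κ (cycle i))        ≡⟨ ∑-distrib-+ (w ∘ leaf) (κ ∘ cycle) ⟩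
    Σ (w ∘ leaf) + Kc                         ≡⟨ cong (_+ Kc) Σ-weight-leaf ⟩
    C + Kc                                    ∎
    where open ≡-Reasoning

  absurd : ⊥
  absurd = m+1+n≢m (C + Kc) (begin
    (C + Kc) + ((n + n) + (Kl + Kl))        ≡⟨ rearrange C (n + n) Kc Kl ⟩
    C + ((n + n) + (Kc + Kl)) + Kl          ≡⟨ cong (λ x → C + x + Kl) Σ-label ⟨
    C + (C + L) + Kl                        ≡⟨ cong (_+ Kl) (+-assoc C C L) ⟨
    C + C + L + Kl                          ≡⟨ Σ-balance ⟩
    C + Kc                                  ∎)
    where
    open ≡-Reasoning
    rearrange : ∀ c s p q → (c + p) + (s + (q + q)) ≡ c + (s + (p + q)) + q
    rearrange = ℕ-Solver.solve-∀

mainTheorem6 : (n : ℕ) → n ≥ 3 → (a : ℤ) → (d : ℕ) → ¬ IsDistanceAntimagic (sun n) a d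
mainTheorem6 (suc (suc (suc k))) _ a d (f , g , weight≡) = AntimagicSun.absurd k a d f g weight≡
mainTheorem6 1 (s≤s ())
mainTheorem6 2 (s≤s (s≤s ()))
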